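{- Let $(a_n,b_n)$, $n\ge1$, be the $P$-positions $(x,y)$ with $0<x\le y$ of Corner the Queen Bee, listed so that $a_1<a_2<\cdots$. Then the sequence $a_{b_n}-a_n-b_n$ ($n\ge1$) is unbounded.
   Context: Positions are pairs $(x,y)$ of nonnegative integers. From $(x,y)$ the Queen Bee may move to: (i) $(x',y)$ with $0\le x'<x$, or $(x,y')$ with $0\le y'<y$; (ii) $(x-s,y-s)$ with $1\le s\le\min(x,y)$; (iii) if $x<y$, to $(t,y-x)$ with $0<t<2x$; if $x>y$, to $(x-y,t)$ with $0<t<2y$. Every move strictly decreases $x+y$. $P$-positions: $(0,0)$ is a $P$-position, and a position is a $P$-position iff it has no move to a $P$-position. -}

module Defs where

open import Data.Nat using (ℕ; zero; suc; _+_; _*_; _∸_; _<ᵇ_; _⊓_)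
open import Data.Bool using (Bool; true; false; not; if_then_else_)
open import Data.List using (List; []; _∷_; _++_; map; upTo)
open import Data.Bool.ListAction using (any)
open import Data.Product using (_×_; _,_)
open import Relation.Binary.PropositionalEquality using (_≡_)

Pos : Set
Pos = ℕ × ℕ

-- All positions reachable in one move of Corner the Queen Bee from (x , y).
-- (i)   (x' , y) with x' < x,  and (x , y') with y' < y
-- (ii)  (x - s , y - s) with 1 ≤ s ≤ min x y
-- (iii) if x < y : (t , y - x) with 0 < t < 2x ;
--       if x > y : (x - y , t) with 0 < t < 2y .
moves : ℕ → ℕ → List Pos
moves x y =
  map (λ x' → (x' , y)) (upTo x)
  ++ map (λ y' → (x , y')) (upTo y)
  ++ map (λ i → (x ∸ suc i , y ∸ suc i)) (upTo (x ⊓ y))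
  ++ (if x <ᵇ y
        then map (λ i → (suc i , y ∸ x)) (upTo (2 * x ∸ 1))
        else (if y <ᵇ x
                then map (λ i → (x ∸ y , suc i)) (upTo (2 * y ∸ 1))
                else []))

-- P-position test with fuel; every move strictly decreases x + y,
-- so fuel x + y + 1 is enough to decide (x , y) exactly.
isPFuel : ℕ → ℕ → ℕ → Bool
isPFuel zero    x y = true
isPFuel (suc k) x y = not (any (λ p → isPFuel' k p) (moves x y))
  where
  isPFuel' : ℕ → Pos → Bool
  isPFuel' k (x' , y') = isPFuel k x' y'

IsP : ℕ → ℕ → Set
IsP x y = isPFuel (suc (x + y)) x y ≡ true

-- The P-positions are (0 , 0), (x , 2x) and (2x , x) for x of even 2-adic valuation:
-- this set is independent under moves and every other position has a move into it, so
-- it is the kernel of the move relation, which is what the recursion defining IsP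
-- computes.  Hence a n is the n-th number of even 2-adic valuation, b n = 2 a n, and a
-- inverts the counting function c of these numbers.  From c (4m) = 2m + c m one gets
-- 3 c (r k) = 2 r k + k for the base-4 repunits r k = (4^k - 1)/3; for k = 4(M + 1)
-- this forces c (r k) = 2x with x odd, and for the n with a n = x the quantity
-- a (b n) - a n - b n = r k - 3x equals -2(M + 1).

module Submission where

open import Defs
open import Data.Bool using (true; false; T; not; if_then_else_)
open import Data.Bool.Properties using (T-≡)
open import Data.Empty using (⊥-elim)
open import Data.Integer using (ℤ; ∣_∣; -_; _-_) renaming (+_ to ⁺; _*_ to _*ℤ_; _+_ to _+ℤ_)
import Data.Integer.Properties as ℤ
import Data.Integer.Tactic.RingSolver as ℤ-Solver
open import Data.List using (List; []; _++_; map; upTo)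
open import Data.List.Membership.Propositional using (_∈_; lose; find)
open import Data.List.Membership.Propositional.Properties
  using (∈-++⁺ˡ; ∈-++⁺ʳ; ∈-++⁻; ∈-map⁺; ∈-map⁻; ∈-upTo⁺; ∈-upTo⁻)
open import Data.List.Relation.Unary.Any.Properties using (any⁺; any⁻)
open import Data.Nat using (ℕ; zero; suc; _+_; _*_; _∸_; _≤_; _<_; z≤n; s≤s; _≟_; _<ᵇ_; _⊓_)
open import Data.Nat.Induction using (<-rec)
open import Data.Nat.Properties
open import Data.Nat.Tactic.RingSolver using (solve-∀)
open import Data.Product using (∃-syntax; _×_; _,_; proj₁)
open import Data.Sum using (_⊎_; inj₁; inj₂)
open import Function.Base using (_∘_; case_of_)
open import Function.Bundles using (_⇔_; mk⇔; Equivalence)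
open import Relation.Binary using (tri<; tri≈; tri>)
open import Relation.Binary.PropositionalEquality
open import Relation.Nullary using (¬_; Dec; yes; no)
open import Relation.Nullary.Decidable using (_×-dec_; _⊎-dec_)
open import Relation.Unary using (Decidable)

open Equivalence using (to; from)
open ≡-Reasoning

data Parity : ℕ → Set where
  even : ∀ m → Parity (2 * m)
  odd  : ∀ m → Parity (suc (2 * m))

parity : ∀ n → Parity n
parity zero = even 0
parity (suc n) with parity n
... | even m = odd m
... | odd m  = subst Parity (*-suc 2 m) (even (suc m))

3*-even⇒even : ∀ c k → 3 * c ≡ 2 * k → ∃[ x ] c ≡ 2 * x
3*-even⇒even c k 3c≡2k with parity c
... | even x = x , refl
... | odd x  = ⊥-elim (even≢odd k (3 * x + 1) (trans (sym 3c≡2k) (triple-odd x)))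
  where
  triple-odd : ∀ x → 3 * suc (2 * x) ≡ suc (2 * (3 * x + 1))
  triple-odd = solve-∀

3*-odd⇒odd : ∀ x k → 3 * x ≡ suc (2 * k) → ∃[ q ] x ≡ suc (2 * q)
3*-odd⇒odd x k 3x≡2k+1 with parity x
... | odd q  = q , refl
... | even q = ⊥-elim (even≢odd (3 * q) k (trans (triple-even q) 3x≡2k+1))
  where
  triple-even : ∀ q → 2 * (3 * q) ≡ 3 * (2 * q)
  triple-even = solve-∀

*4≡2*[2*] : ∀ n → n * 4 ≡ 2 * (2 * n)
*4≡2*[2*] = solve-∀

n<2*n : ∀ {n} → 0 < n → n < 2 * n
n<2*n {suc n} _ = m<m+n (suc n) (s≤s z≤n)

n≤2*[2*n] : ∀ n → n ≤ 2 * (2 * n)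
n≤2*[2*n] n = ≤-trans (m≤n*m n 2) (m≤n*m (2 * n) 2)

∣y-x-2x∣ : ∀ {x y d} → 3 * x ≡ y + d → ∣ ⁺ y - ⁺ x - ⁺ (2 * x) ∣ ≡ d
∣y-x-2x∣ {x} {y} {d} 3x≡y+d = trans (cong ∣_∣ y-x-2x≡-d) (ℤ.∣-i∣≡∣i∣ (⁺ d))
  where
  collect : ∀ (j i : ℤ) → j - i - ⁺ 2 *ℤ i ≡ j - ⁺ 3 *ℤ i
  collect = ℤ-Solver.solve-∀
  cancel : ∀ (j e : ℤ) → j - (j +ℤ e) ≡ - e
  cancel = ℤ-Solver.solve-∀

  y-x-2x≡-d : ⁺ y - ⁺ x - ⁺ (2 * x) ≡ - ⁺ d
  y-x-2x≡-d = begin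
    ⁺ y - ⁺ x - ⁺ (2 * x)   ≡⟨ cong (λ i → ⁺ y - ⁺ x - i) (ℤ.pos-* 2 x) ⟩
    ⁺ y - ⁺ x - ⁺ 2 *ℤ ⁺ x  ≡⟨ collect (⁺ y) (⁺ x) ⟩
    ⁺ y - ⁺ 3 *ℤ ⁺ x        ≡⟨ cong (λ i → ⁺ y - i) (sym (ℤ.pos-* 3 x)) ⟩
    ⁺ y - ⁺ (3 * x)         ≡⟨ cong (λ n → ⁺ y - ⁺ n) 3x≡y+d ⟩
    ⁺ y - ⁺ (y + d)         ≡⟨ cong (λ i → ⁺ y - i) (ℤ.pos-+ y d) ⟩
    ⁺ y - (⁺ y +ℤ ⁺ d)      ≡⟨ cancel (⁺ y) (⁺ d) ⟩
    - ⁺ d                   ∎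

-- Numbers of even 2-adic valuation

data EvenV₂ : ℕ → Set where
  odd       : ∀ m → EvenV₂ (suc (2 * m))
  quadruple : ∀ {m} → EvenV₂ m → EvenV₂ (2 * (2 * m))

odd⇒EvenV₂ : ∀ {n} → ∃[ q ] n ≡ suc (2 * q) → EvenV₂ n
odd⇒EvenV₂ (q , refl) = odd q

EvenV₂⇒>0 : ∀ {n} → EvenV₂ n → 0 < n
EvenV₂⇒>0 (odd m)       = s≤s z≤n
EvenV₂⇒>0 (quadruple e) = *-monoʳ-< 2 (*-monoʳ-< 2 (EvenV₂⇒>0 e))

EvenV₂-half : ∀ {n} → EvenV₂ (2 * n) → ∃[ m ] (n ≡ 2 * m × EvenV₂ m)
EvenV₂-half {n} e = go e refl
  where
  go : ∀ {k} → EvenV₂ k → k ≡ 2 * n → ∃[ m ] (n ≡ 2 * m × EvenV₂ m)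
  go (odd m)            eq = ⊥-elim (even≢odd n m (sym eq))
  go (quadruple {m} e′) eq = m , sym (*-cancelˡ-≡ (2 * m) n 2 eq) , e′

EvenV₂⇒¬EvenV₂-double : ∀ {n} → EvenV₂ n → ¬ EvenV₂ (2 * n)
EvenV₂⇒¬EvenV₂-double (odd m) e with EvenV₂-half e
... | k , eq , _ = even≢odd k m (sym eq)
EvenV₂⇒¬EvenV₂-double (quadruple {m} d) e with EvenV₂-half e
... | k , eq , ek = EvenV₂⇒¬EvenV₂-double d (subst EvenV₂ (sym (*-cancelˡ-≡ (2 * m) k 2 eq)) ek)

EvenV₂-quadruple⁻ : ∀ {n} → EvenV₂ (2 * (2 * n)) → EvenV₂ n
EvenV₂-quadruple⁻ {n} e with EvenV₂-half e
... | k , eq , ek = subst EvenV₂ (sym (*-cancelˡ-≡ n k 2 eq)) ek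

EvenV₂-or-double : ∀ n → 0 < n → EvenV₂ n ⊎ ∃[ z ] (EvenV₂ z × n ≡ 2 * z)
EvenV₂-or-double = <-rec _ step
  where
  step : ∀ n → (∀ {m} → m < n → 0 < m → EvenV₂ m ⊎ ∃[ z ] (EvenV₂ z × m ≡ 2 * z))
       → 0 < n → EvenV₂ n ⊎ ∃[ z ] (EvenV₂ z × n ≡ 2 * z)
  step n rec n>0 with parity n
  ... | odd m        = inj₁ (odd m)
  ... | even zero    = ⊥-elim (n≮0 n>0)
  ... | even (suc k) with rec (n<2*n (s≤s z≤n)) (s≤s z≤n)
  ...   | inj₁ ek                = inj₂ (suc k , ek , refl)
  ...   | inj₂ (z , ez , k+1≡2z) = inj₁ (subst (λ m → EvenV₂ (2 * m)) (sym k+1≡2z) (quadruple ez))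

EvenV₂? : Decidable EvenV₂
EvenV₂? zero    = no (n≮0 ∘ EvenV₂⇒>0)
EvenV₂? (suc n) with EvenV₂-or-double (suc n) (s≤s z≤n)
... | inj₁ e             = yes e
... | inj₂ (z , ez , eq) = no (λ e → EvenV₂⇒¬EvenV₂-double ez (subst EvenV₂ eq e))

data Move (x y : ℕ) : ℕ → ℕ → Set where
  horizontal : ∀ {x′} → x′ < x → Move x y x′ y
  vertical   : ∀ {y′} → y′ < y → Move x y x y′
  diagonal   : ∀ {u v} s → 0 < s → x ≡ u + s → y ≡ v + s → Move x y u v
  jump<      : ∀ {t w} → x < y → 0 < t → t < 2 * x → y ≡ x + w → Move x y t w
  jump>      : ∀ {t w} → y < x → 0 < t → t < 2 * y → x ≡ y + w → Move x y w t

Move⇒sum< : ∀ {x y u v} → Move x y u v → u + v < x + y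
Move⇒sum< {y = y} (horizontal x′<x) = +-monoˡ-< y x′<x
Move⇒sum< {x = x} (vertical y′<y)   = +-monoʳ-< x y′<y
Move⇒sum< {u = u} (diagonal s s>0 refl refl) = +-mono-≤-< (m≤m+n u s) (m<m+n _ s>0)
Move⇒sum< {x} {u = t} {v = w} (jump< _ _ t<2x refl) = subst (t + w <_) (rearrange x w) (+-monoˡ-< w t<2x)
  where
  rearrange : ∀ x w → 2 * x + w ≡ x + (x + w)
  rearrange = solve-∀
Move⇒sum< {y = y} {u = w} {v = t} (jump> _ _ t<2y refl) = subst (w + t <_) (rearrange y w) (+-monoʳ-< w t<2y)
  where
  rearrange : ∀ y w → w + 2 * y ≡ y + w + y
  rearrange = solve-∀

Move-swap : ∀ {x y u v} → Move x y u v → Move y x v u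
Move-swap (horizontal x′<x)         = vertical x′<x
Move-swap (vertical y′<y)           = horizontal y′<y
Move-swap (diagonal s s>0 x≡ y≡)    = diagonal s s>0 y≡ x≡
Move-swap (jump< x<y t>0 t<2x y≡)   = jump> x<y t>0 t<2x y≡
Move-swap (jump> y<x t>0 t<2y x≡)   = jump< y<x t>0 t<2y x≡

<ᵇ≡true : ∀ {m n} → m < n → (m <ᵇ n) ≡ true
<ᵇ≡true = to T-≡ ∘ <⇒<ᵇ

<ᵇ≡true⇒< : ∀ {m n} → (m <ᵇ n) ≡ true → m < n
<ᵇ≡true⇒< {m} {n} = <ᵇ⇒< m n ∘ from T-≡

<ᵇ≡false : ∀ {m n} → ¬ (m < n) → (m <ᵇ n) ≡ false
<ᵇ≡false {m} {n} m≮n with m <ᵇ n in m<ᵇn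
... | false = refl
... | true  = ⊥-elim (m≮n (<ᵇ≡true⇒< m<ᵇn))

suc<⇒<∸1 : ∀ {i n} → suc i < n → i < n ∸ 1
suc<⇒<∸1 {n = suc n} (s≤s i<n) = i<n

<∸1⇒suc< : ∀ {i n} → i < n ∸ 1 → suc i < n
<∸1⇒suc< {n = suc n} i<n = s≤s i<n

horizontalMoves verticalMoves diagonalMoves jump<Moves jump>Moves : ℕ → ℕ → List Pos
horizontalMoves x y = map (λ x′ → (x′ , y)) (upTo x)
verticalMoves   x y = map (λ y′ → (x , y′)) (upTo y)
diagonalMoves   x y = map (λ i → (x ∸ suc i , y ∸ suc i)) (upTo (x ⊓ y))
jump<Moves      x y = map (λ i → (suc i , y ∸ x)) (upTo (2 * x ∸ 1))
jump>Moves      x y = map (λ i → (x ∸ y , suc i)) (upTo (2 * y ∸ 1))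

∈-moves⁺ : ∀ {x y u v} → Move x y u v → (u , v) ∈ moves x y
∈-moves⁺ (horizontal x′<x) = ∈-++⁺ˡ (∈-map⁺ _ (∈-upTo⁺ x′<x))
∈-moves⁺ {x} {y} (vertical y′<y) = ∈-++⁺ʳ (horizontalMoves x y) (∈-++⁺ˡ (∈-map⁺ _ (∈-upTo⁺ y′<y)))
∈-moves⁺ {x} {y} {u} {v} (diagonal (suc s) _ refl refl) =
  ∈-++⁺ʳ (horizontalMoves x y) (∈-++⁺ʳ (verticalMoves x y) (∈-++⁺ˡ
    (subst (_∈ diagonalMoves x y) pair (∈-map⁺ (λ i → (x ∸ suc i , y ∸ suc i)) (∈-upTo⁺ s<x⊓y)))))
  where
  s<x⊓y : s < x ⊓ y
  s<x⊓y = ⊓-glb (m≤n+m (suc s) u) (m≤n+m (suc s) v)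
  pair : (u + suc s ∸ suc s , v + suc s ∸ suc s) ≡ (u , v)
  pair = cong₂ _,_ (m+n∸n≡m u (suc s)) (m+n∸n≡m v (suc s))
∈-moves⁺ {x} {y} {suc t} {w} (jump< x<y _ t<2x refl) rewrite <ᵇ≡true x<y =
  ∈-++⁺ʳ (horizontalMoves x y) (∈-++⁺ʳ (verticalMoves x y) (∈-++⁺ʳ (diagonalMoves x y)
    (subst (_∈ jump<Moves x y) pair (∈-map⁺ (λ i → (suc i , y ∸ x)) (∈-upTo⁺ (suc<⇒<∸1 t<2x))))))
  where
  pair : (suc t , x + w ∸ x) ≡ (suc t , w)
  pair = cong (suc t ,_) (m+n∸m≡n x w)
∈-moves⁺ {x} {y} {w} {suc t} (jump> y<x _ t<2y refl) rewrite <ᵇ≡false (<⇒≯ y<x) | <ᵇ≡true y<x =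
  ∈-++⁺ʳ (horizontalMoves x y) (∈-++⁺ʳ (verticalMoves x y) (∈-++⁺ʳ (diagonalMoves x y)
    (subst (_∈ jump>Moves x y) pair (∈-map⁺ (λ i → (x ∸ y , suc i)) (∈-upTo⁺ (suc<⇒<∸1 t<2y))))))
  where
  pair : (y + w ∸ y , suc t) ≡ (w , suc t)
  pair = cong (_, suc t) (m+n∸m≡n y w)

∈-jumpMoves⁻ : ∀ x y {u v}
             → (u , v) ∈ (if x <ᵇ y then jump<Moves x y else (if y <ᵇ x then jump>Moves x y else []))
             → Move x y u v
∈-jumpMoves⁻ x y h with x <ᵇ y in x<ᵇy
... | true with ∈-map⁻ (λ i → (suc i , y ∸ x)) h
...   | i , i∈ , refl = jump< x<y (s≤s z≤n) (<∸1⇒suc< (∈-upTo⁻ i∈)) (sym (m+[n∸m]≡n (<⇒≤ x<y)))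
  where x<y = <ᵇ≡true⇒< x<ᵇy
∈-jumpMoves⁻ x y h | false with y <ᵇ x in y<ᵇx
... | true with ∈-map⁻ (λ i → (x ∸ y , suc i)) h
...   | i , i∈ , refl = jump> y<x (s≤s z≤n) (<∸1⇒suc< (∈-upTo⁻ i∈)) (sym (m+[n∸m]≡n (<⇒≤ y<x)))
  where y<x = <ᵇ≡true⇒< y<ᵇx
∈-jumpMoves⁻ x y () | false | false

∈-moves⁻ : ∀ {x y u v} → (u , v) ∈ moves x y → Move x y u v
∈-moves⁻ {x} {y} mem with ∈-++⁻ (horizontalMoves x y) mem
... | inj₁ h with ∈-map⁻ (λ x′ → (x′ , y)) h
...   | _ , x′∈ , refl = horizontal (∈-upTo⁻ x′∈)
∈-moves⁻ {x} {y} mem | inj₂ mem′ with ∈-++⁻ (verticalMoves x y) mem′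
... | inj₁ h with ∈-map⁻ (λ y′ → (x , y′)) h
...   | _ , y′∈ , refl = vertical (∈-upTo⁻ y′∈)
∈-moves⁻ {x} {y} mem | inj₂ mem′ | inj₂ mem″ with ∈-++⁻ (diagonalMoves x y) mem″
... | inj₁ h with ∈-map⁻ (λ i → (x ∸ suc i , y ∸ suc i)) h
...   | i , i∈ , refl = diagonal (suc i) (s≤s z≤n)
                          (sym (m∸n+n≡m (≤-trans (∈-upTo⁻ i∈) (m⊓n≤m x y))))
                          (sym (m∸n+n≡m (≤-trans (∈-upTo⁻ i∈) (m⊓n≤n x y))))
∈-moves⁻ {x} {y} mem | inj₂ mem′ | inj₂ mem″ | inj₂ h = ∈-jumpMoves⁻ x y h

-- P-positions as the kernel of the move relation

not≡true⇔¬T : ∀ b → not b ≡ true ⇔ (¬ T b)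
not≡true⇔¬T false = mk⇔ (λ _ ()) (λ _ → refl)
not≡true⇔¬T true  = mk⇔ (λ ()) (λ ¬t → ⊥-elim (¬t _))

MoveTo : (ℕ → ℕ → Set) → ℕ → ℕ → Set
MoveTo S x y = ∃[ u ] ∃[ v ] (Move x y u v × S u v)

Independent Absorbing : (ℕ → ℕ → Set) → Set
Independent S = ∀ {x y u v} → S x y → Move x y u v → ¬ S u v
Absorbing   S = ∀ {x y} → ¬ S x y → MoveTo S x y

module _ {S : ℕ → ℕ → Set} (S? : ∀ x y → Dec (S x y))
         (independent : Independent S) (absorbing : Absorbing S) where

  isPFuel⇔kernel : ∀ k {x y} → x + y < k → isPFuel k x y ≡ true ⇔ S x y
  isPFuel⇔kernel (suc k) {x} {y} (s≤s x+y≤k) = mk⇔ sound complete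
    where
    IH : ∀ {u v} → Move x y u v → isPFuel k u v ≡ true ⇔ S u v
    IH m = isPFuel⇔kernel k (≤-trans (Move⇒sum< m) x+y≤k)

    sound : isPFuel (suc k) x y ≡ true → S x y
    sound isP with S? x y
    ... | yes s = s
    ... | no ¬s with absorbing ¬s
    ...   | _ , _ , m , s =
      ⊥-elim (to (not≡true⇔¬T _) isP (any⁺ _ (lose (∈-moves⁺ m) (from T-≡ (from (IH m) s)))))

    complete : S x y → isPFuel (suc k) x y ≡ true
    complete s = from (not≡true⇔¬T _) λ t → case find (any⁻ _ (moves x y) t) of λ where
      ((u , v) , mem , isP) → independent s (∈-moves⁻ mem) (to (IH (∈-moves⁻ mem)) (to T-≡ isP))

  IsP⇔kernel : ∀ {x y} → IsP x y ⇔ S x y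
  IsP⇔kernel = isPFuel⇔kernel _ ≤-refl

-- The P-positions of Corner the Queen Bee

QueenBeeP : ℕ → ℕ → Set
QueenBeeP x y = (x ≡ 0 × y ≡ 0) ⊎ (EvenV₂ x × y ≡ 2 * x) ⊎ (EvenV₂ y × x ≡ 2 * y)

QueenBeeP? : ∀ x y → Dec (QueenBeeP x y)
QueenBeeP? x y = ((x ≟ 0) ×-dec (y ≟ 0))
            ⊎-dec ((EvenV₂? x ×-dec (y ≟ 2 * x)) ⊎-dec (EvenV₂? y ×-dec (x ≟ 2 * y)))

QueenBeeP-swap : ∀ {x y} → QueenBeeP x y → QueenBeeP y x
QueenBeeP-swap (inj₁ (x≡0 , y≡0)) = inj₁ (y≡0 , x≡0)
QueenBeeP-swap (inj₂ (inj₁ p))    = inj₂ (inj₂ p)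
QueenBeeP-swap (inj₂ (inj₂ p))    = inj₂ (inj₁ p)

diagonal-from-double∉QueenBeeP : ∀ {z u v s} → z ≡ u + suc s → 2 * z ≡ v + suc s → ¬ QueenBeeP u v
diagonal-from-double∉QueenBeeP {z} {u} {v} {s} z≡u+s 2z≡v+s = not-P
  where
  v≡2u+s : v ≡ 2 * u + suc s
  v≡2u+s = +-cancelʳ-≡ (suc s) v (2 * u + suc s) (begin
    v + suc s             ≡⟨ sym 2z≡v+s ⟩
    2 * z                 ≡⟨ cong (2 *_) z≡u+s ⟩
    2 * (u + suc s)       ≡⟨ distribute u (suc s) ⟩
    2 * u + suc s + suc s ∎)
    where
    distribute : ∀ u s → 2 * (u + s) ≡ 2 * u + s + s
    distribute = solve-∀

  not-P : ¬ QueenBeeP u v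
  not-P (inj₁ (refl , refl))     = 0≢1+n v≡2u+s
  not-P (inj₂ (inj₁ (_ , v≡2u))) = m+1+n≢m (2 * u) (trans (sym v≡2u+s) v≡2u)
  not-P (inj₂ (inj₂ (_ , u≡2v))) =
    <⇒≱ (subst (u <_) (sym v≡2u+s) (≤-<-trans (m≤n*m u 2) (m<m+n (2 * u) (s≤s z≤n))))
        (subst (v ≤_) (sym u≡2v) (m≤n*m v 2))

jump-from-double∉QueenBeeP : ∀ {z t w} → EvenV₂ z → 0 < t → t < 2 * z → 2 * z ≡ z + w → ¬ QueenBeeP t w
jump-from-double∉QueenBeeP {z} {t} {w} ez t>0 t<2z 2z≡z+w = not-P
  where
  z≡w : z ≡ w
  z≡w = trans (sym (+-identityʳ z)) (+-cancelˡ-≡ z (z + 0) w 2z≡z+w)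

  not-P : ¬ QueenBeeP t w
  not-P (inj₁ (t≡0 , _))          = <⇒≢ t>0 (sym t≡0)
  not-P (inj₂ (inj₁ (et , w≡2t))) = EvenV₂⇒¬EvenV₂-double et (subst EvenV₂ (trans z≡w w≡2t) ez)
  not-P (inj₂ (inj₂ (_ , t≡2w)))  = <⇒≢ t<2z (trans t≡2w (cong (2 *_) (sym z≡w)))

move-from-double∉QueenBeeP : ∀ {z u v} → EvenV₂ z → Move z (2 * z) u v → ¬ QueenBeeP u v
move-from-double∉QueenBeeP {z} ez = from-double
  where
  z>0 : 0 < z
  z>0 = EvenV₂⇒>0 ez

  from-double : ∀ {u v} → Move z (2 * z) u v → ¬ QueenBeeP u v
  from-double (horizontal u<z) (inj₁ (_ , 2z≡0))         = <⇒≢ (*-monoʳ-< 2 z>0) (sym 2z≡0)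
  from-double (horizontal u<z) (inj₂ (inj₁ (_ , 2z≡2u))) = <⇒≢ u<z (sym (*-cancelˡ-≡ _ _ 2 2z≡2u))
  from-double (horizontal u<z) (inj₂ (inj₂ (_ , u≡4z)))  = <⇒≱ u<z (subst (z ≤_) (sym u≡4z) (n≤2*[2*n] z))
  from-double (vertical _)     (inj₁ (z≡0 , _))          = <⇒≢ z>0 (sym z≡0)
  from-double (vertical v<2z)  (inj₂ (inj₁ (_ , v≡2z)))  = <⇒≢ v<2z v≡2z
  from-double (vertical _)     (inj₂ (inj₂ (ev , z≡2v))) = EvenV₂⇒¬EvenV₂-double ev (subst EvenV₂ z≡2v ez)
  from-double (diagonal (suc _) _ z≡u+s 2z≡v+s)          = diagonal-from-double∉QueenBeeP z≡u+s 2z≡v+s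
  from-double (jump< _ t>0 t<2z 2z≡z+w)                  = jump-from-double∉QueenBeeP ez t>0 t<2z 2z≡z+w
  from-double (jump> 2z<z _ _ _) _                       = <⇒≱ 2z<z (m≤n*m z 2)

QueenBeeP-independent : Independent QueenBeeP
QueenBeeP-independent (inj₁ (refl , refl)) m     = ⊥-elim (n≮0 (Move⇒sum< m))
QueenBeeP-independent (inj₂ (inj₁ (ex , refl))) m = move-from-double∉QueenBeeP ex m
QueenBeeP-independent (inj₂ (inj₂ (ey , refl))) m =
  move-from-double∉QueenBeeP ey (Move-swap m) ∘ QueenBeeP-swap

QueenBeeP-absorbing-short : ∀ {x w} → EvenV₂ x → w < x → MoveTo QueenBeeP x (x + w)
QueenBeeP-absorbing-short {x} {zero} ex _ =
  0 , 0 , diagonal x (EvenV₂⇒>0 ex) refl (+-identityʳ x) , inj₁ (refl , refl)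
QueenBeeP-absorbing-short {x} {w@(suc _)} ex w<x = jump-into (EvenV₂-or-double w (s≤s z≤n))
  where
  x<x+w : x < x + w
  x<x+w = m<m+n x (s≤s z≤n)

  jump-into : EvenV₂ w ⊎ ∃[ u ] (EvenV₂ u × w ≡ 2 * u) → MoveTo QueenBeeP x (x + w)
  jump-into (inj₁ ew) =
    2 * w , w , jump< x<x+w (*-monoʳ-< 2 (s≤s z≤n)) (*-monoʳ-< 2 w<x) refl , inj₂ (inj₂ (ew , refl))
  jump-into (inj₂ (u , eu , w≡2u)) =
    u , w , jump< x<x+w (EvenV₂⇒>0 eu) u<2x refl , inj₂ (inj₁ (eu , w≡2u))
    where
    u<2x = <-trans (subst (u <_) (sym w≡2u) (n<2*n (EvenV₂⇒>0 eu))) (<-trans w<x (n<2*n (EvenV₂⇒>0 ex)))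

QueenBeeP-absorbing-≤ : ∀ {x y} → x ≤ y → ¬ QueenBeeP x y → MoveTo QueenBeeP x y
QueenBeeP-absorbing-≤ {zero} {zero}  _ ¬P = ⊥-elim (¬P (inj₁ (refl , refl)))
QueenBeeP-absorbing-≤ {zero} {suc y} _ _  = 0 , 0 , vertical (s≤s z≤n) , inj₁ (refl , refl)
QueenBeeP-absorbing-≤ {x@(suc _)} {y} x≤y ¬P with EvenV₂-or-double x (s≤s z≤n)
... | inj₂ (z , ez , x≡2z) =
  x , z , vertical (<-≤-trans (subst (z <_) (sym x≡2z) (n<2*n (EvenV₂⇒>0 ez))) x≤y) , inj₂ (inj₂ (ez , x≡2z))
... | inj₁ ex with <-cmp y (2 * x)
...   | tri> _ _ y>2x = x , 2 * x , vertical y>2x , inj₂ (inj₁ (ex , refl))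
...   | tri≈ _ y≡2x _ = ⊥-elim (¬P (inj₂ (inj₁ (ex , y≡2x))))
...   | tri< y<2x _ _ = subst (MoveTo QueenBeeP x) (m+[n∸m]≡n x≤y) (QueenBeeP-absorbing-short ex y∸x<x)
  where
  y∸x<x : y ∸ x < x
  y∸x<x = m<n+o⇒m∸n<o y x (subst (y <_) (cong (x +_) (+-identityʳ x)) y<2x)

QueenBeeP-absorbing : Absorbing QueenBeeP
QueenBeeP-absorbing {x} {y} ¬P with ≤-total x y
... | inj₁ x≤y = QueenBeeP-absorbing-≤ x≤y ¬P
... | inj₂ y≤x with QueenBeeP-absorbing-≤ y≤x (¬P ∘ QueenBeeP-swap)
...   | u , v , m , p = v , u , Move-swap m , QueenBeeP-swap p

IsP⇔QueenBeeP : ∀ {x y} → IsP x y ⇔ QueenBeeP x y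
IsP⇔QueenBeeP = IsP⇔kernel QueenBeeP? QueenBeeP-independent QueenBeeP-absorbing

QueenBeeP-ordered : ∀ {x y} → 0 < x → x ≤ y → QueenBeeP x y → EvenV₂ x × y ≡ 2 * x
QueenBeeP-ordered x>0 _   (inj₁ (x≡0 , _))        = ⊥-elim (<⇒≢ x>0 (sym x≡0))
QueenBeeP-ordered _   _   (inj₂ (inj₁ p))         = p
QueenBeeP-ordered x>0 x≤y (inj₂ (inj₂ (ey , x≡2y))) =
  ⊥-elim (<⇒≱ (subst (_ <_) (sym x≡2y) (n<2*n (EvenV₂⇒>0 ey))) x≤y)

IsP-double : ∀ {z} → EvenV₂ z → IsP z (2 * z)
IsP-double ez = from IsP⇔QueenBeeP (inj₂ (inj₁ (ez , refl)))

-- Counting the elements of a decidable set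

module _ {P : ℕ → Set} (P? : Decidable P) where

  count : ℕ → ℕ
  count zero = 0
  count (suc n) with P? (suc n)
  ... | yes _ = suc (count n)
  ... | no _  = count n

  count-suc-yes : ∀ {n} → P (suc n) → count (suc n) ≡ suc (count n)
  count-suc-yes {n} p with P? (suc n)
  ... | yes _ = refl
  ... | no ¬p = ⊥-elim (¬p p)

  count-suc-no : ∀ {n} → ¬ P (suc n) → count (suc n) ≡ count n
  count-suc-no {n} ¬p with P? (suc n)
  ... | yes p = ⊥-elim (¬p p)
  ... | no _  = refl

  count-constant : ∀ {m n} → m ≤ n → (∀ {i} → m < i → i ≤ n → ¬ P i) → count n ≡ count m
  count-constant {m} {n} m≤n gap with m≤n⇒m<n∨m≡n m≤n
  ... | inj₂ refl = refl
  ... | inj₁ (s≤s m≤n′) =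
    trans (count-suc-no (gap (s≤s m≤n′) ≤-refl)) (count-constant m≤n′ (λ m<i i≤n′ → gap m<i (m≤n⇒m≤1+n i≤n′)))

  count-step : ∀ {m y} → P y → m < y → (∀ {i} → m < i → i < y → ¬ P i) → count y ≡ suc (count m)
  count-step {y = suc y} p (s≤s m≤y) gap =
    trans (count-suc-yes p) (cong suc (count-constant m≤y (λ m<i i≤y → gap m<i (s≤s i≤y))))

  module _ (a : ℕ → ℕ) (a-mono : ∀ j k → 1 ≤ j → j < k → a j < a k) (¬P0 : ¬ P 0)
           (a-∈ : ∀ k → 1 ≤ k → P (a k)) (a-onto : ∀ {y} → P y → ∃[ j ] (1 ≤ j × a j ≡ y)) where

    a-reflects-< : ∀ {j k} → 1 ≤ j → 1 ≤ k → a j < a k → j < k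
    a-reflects-< {j} {k} 1≤j 1≤k aj<ak with <-cmp j k
    ... | tri< j<k _ _  = j<k
    ... | tri≈ _ refl _ = ⊥-elim (<-irrefl refl aj<ak)
    ... | tri> _ _ k<j  = ⊥-elim (<-asym aj<ak (a-mono k j 1≤k k<j))

    a-onto-below : ∀ {k i} → 1 ≤ k → i < a k → P i → ∃[ j ] (1 ≤ j × j < k × a j ≡ i)
    a-onto-below 1≤k i<ak p with a-onto p
    ... | j , 1≤j , refl = j , 1≤j , a-reflects-< 1≤j 1≤k i<ak , refl

    count∘a : ∀ k → 1 ≤ k → count (a k) ≡ k
    count∘a (suc zero) _ = count-step (a-∈ 1 ≤-refl) (n≢0⇒n>0 (λ a1≡0 → ¬P0 (subst P a1≡0 (a-∈ 1 ≤-refl)))) gap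
      where
      gap : ∀ {i} → 0 < i → i < a 1 → ¬ P i
      gap _ i<a1 p with a-onto-below ≤-refl i<a1 p
      ... | j , 1≤j , j<1 , _ = <⇒≱ j<1 1≤j
    count∘a (suc (suc k)) _ =
      trans (count-step (a-∈ (2 + k) (s≤s z≤n)) (a-mono (suc k) (2 + k) (s≤s z≤n) ≤-refl) gap)
            (cong suc (count∘a (suc k) (s≤s z≤n)))
      where
      gap : ∀ {i} → a (suc k) < i → i < a (2 + k) → ¬ P i
      gap ak<i i<ak+1 p with a-onto-below (s≤s z≤n) i<ak+1 p
      ... | j , 1≤j , j<k+2 , refl = <⇒≱ (a-reflects-< (s≤s z≤n) 1≤j ak<i) (≤-pred j<k+2)

    a∘count : ∀ {y} → P y → a (count y) ≡ y
    a∘count p with a-onto p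
    ... | j , 1≤j , refl = cong a (count∘a j 1≤j)

-- Counting numbers of even 2-adic valuation

countEvenV₂ : ℕ → ℕ
countEvenV₂ = count EvenV₂?

countEvenV₂-*4 : ∀ m → countEvenV₂ (m * 4) ≡ m * 2 + countEvenV₂ m
countEvenV₂-*4 zero    = refl
countEvenV₂-*4 (suc m) = last-step (EvenV₂? (suc m))
  where
  c = countEvenV₂

  first-three : c (3 + m * 4) ≡ 2 + (m * 2 + c m)
  first-three = begin
    c (3 + m * 4)       ≡⟨ count-suc-yes EvenV₂? (subst EvenV₂ (4m+3 m) (odd (suc (m * 2)))) ⟩
    suc (c (2 + m * 4)) ≡⟨ cong suc (count-suc-no EvenV₂? (EvenV₂⇒¬EvenV₂-double (odd m) ∘ subst EvenV₂ (4m+2 m))) ⟩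
    suc (c (1 + m * 4)) ≡⟨ cong suc (count-suc-yes EvenV₂? (subst EvenV₂ (4m+1 m) (odd (m * 2)))) ⟩
    2 + c (m * 4)       ≡⟨ cong (2 +_) (countEvenV₂-*4 m) ⟩
    2 + (m * 2 + c m)   ∎
    where
    4m+1 : ∀ m → suc (2 * (m * 2)) ≡ 1 + m * 4
    4m+1 = solve-∀
    4m+2 : ∀ m → 2 + m * 4 ≡ 2 * suc (2 * m)
    4m+2 = solve-∀
    4m+3 : ∀ m → suc (2 * suc (m * 2)) ≡ 3 + m * 4
    4m+3 = solve-∀

  last-step : Dec (EvenV₂ (suc m)) → c (suc m * 4) ≡ suc m * 2 + c (suc m)
  last-step (yes e) = begin
    c (suc m * 4)             ≡⟨ count-suc-yes EvenV₂? (subst EvenV₂ (sym (*4≡2*[2*] (suc m))) (quadruple e)) ⟩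
    suc (c (3 + m * 4))       ≡⟨ cong suc first-three ⟩
    3 + (m * 2 + c m)         ≡⟨ cong (2 +_) (sym (+-suc (m * 2) (c m))) ⟩
    2 + (m * 2 + suc (c m))   ≡⟨ cong (λ k → 2 + (m * 2 + k)) (sym (count-suc-yes EvenV₂? e)) ⟩
    suc m * 2 + c (suc m)     ∎
  last-step (no ¬e) = begin
    c (suc m * 4)             ≡⟨ count-suc-no EvenV₂? (¬e ∘ EvenV₂-quadruple⁻ ∘ subst EvenV₂ (*4≡2*[2*] (suc m))) ⟩
    c (3 + m * 4)             ≡⟨ first-three ⟩
    2 + (m * 2 + c m)         ≡⟨ cong (λ k → 2 + (m * 2 + k)) (sym (count-suc-no EvenV₂? ¬e)) ⟩
    suc m * 2 + c (suc m)     ∎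

repunit₄ : ℕ → ℕ
repunit₄ zero    = 0
repunit₄ (suc k) = suc (repunit₄ k * 4)

countEvenV₂-repunit₄ : ∀ k → 3 * countEvenV₂ (repunit₄ k) ≡ 2 * repunit₄ k + k
countEvenV₂-repunit₄ zero    = refl
countEvenV₂-repunit₄ (suc k) = begin
  3 * countEvenV₂ (suc (r * 4))      ≡⟨ cong (3 *_) (count-suc-yes EvenV₂? (subst EvenV₂ (4r+1 r) (odd (r * 2)))) ⟩
  3 * suc (countEvenV₂ (r * 4))      ≡⟨ cong (λ c → 3 * suc c) (countEvenV₂-*4 r) ⟩
  3 * suc (r * 2 + countEvenV₂ r)    ≡⟨ distribute r (countEvenV₂ r) ⟩
  3 + r * 6 + 3 * countEvenV₂ r      ≡⟨ cong (3 + r * 6 +_) (countEvenV₂-repunit₄ k) ⟩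
  3 + r * 6 + (2 * r + k)            ≡⟨ collect r k ⟩
  2 * suc (r * 4) + suc k            ∎
  where
  r = repunit₄ k
  4r+1 : ∀ r → suc (2 * (r * 2)) ≡ suc (r * 4)
  4r+1 = solve-∀
  distribute : ∀ r c → 3 * suc (r * 2 + c) ≡ 3 + r * 6 + 3 * c
  distribute = solve-∀
  collect : ∀ r k → 3 + r * 6 + (2 * r + k) ≡ 2 * suc (r * 4) + suc k
  collect = solve-∀

countEvenV₂-defect : ∀ m → ∃[ x ] ∃[ Y ] (EvenV₂ x × EvenV₂ Y × countEvenV₂ Y ≡ 2 * x × 3 * x ≡ Y + suc m * 2)
countEvenV₂-defect m =
  let (x , c≡2x)        = 3*-even⇒even c (Y + suc m * 2) 3c≡2[Y+2d]
      (ex , 3x≡Y+2d)    = halve c≡2x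
  in  x , Y , ex , subst EvenV₂ (sym Y≡2[2r]+1) (odd (r * 2)) , c≡2x , 3x≡Y+2d
  where
  r = repunit₄ (3 + m * 4)
  Y = repunit₄ (suc m * 4)
  c = countEvenV₂ Y

  Y≡2[2r]+1 : Y ≡ suc (2 * (r * 2))
  Y≡2[2r]+1 = cong suc (shuffle r)
    where
    shuffle : ∀ r → r * 4 ≡ 2 * (r * 2)
    shuffle = solve-∀

  3c≡2[Y+2d] : 3 * c ≡ 2 * (Y + suc m * 2)
  3c≡2[Y+2d] = trans (countEvenV₂-repunit₄ (suc m * 4)) (factor Y m)
    where
    factor : ∀ Y m → 2 * Y + suc m * 4 ≡ 2 * (Y + suc m * 2)
    factor = solve-∀

  halve : ∀ {x} → c ≡ 2 * x → EvenV₂ x × 3 * x ≡ Y + suc m * 2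
  halve {x} c≡2x = ex , 3x≡Y+2d
    where
    3x≡Y+2d : 3 * x ≡ Y + suc m * 2
    3x≡Y+2d = *-cancelˡ-≡ (3 * x) (Y + suc m * 2) 2 (begin
      2 * (3 * x)        ≡⟨ swap-factors x ⟩
      3 * (2 * x)        ≡⟨ cong (3 *_) (sym c≡2x) ⟩
      3 * c              ≡⟨ 3c≡2[Y+2d] ⟩
      2 * (Y + suc m * 2) ∎)
      where
      swap-factors : ∀ x → 2 * (3 * x) ≡ 3 * (2 * x)
      swap-factors = solve-∀
    3x-odd : 3 * x ≡ suc (2 * (r * 2 + suc m))
    3x-odd = trans 3x≡Y+2d (trans (cong (_+ suc m * 2) Y≡2[2r]+1) (regroup (r * 2) m))
      where
      regroup : ∀ q m → suc (2 * q) + suc m * 2 ≡ suc (2 * (q + suc m))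
      regroup = solve-∀
    ex : EvenV₂ x
    ex = odd⇒EvenV₂ (3*-odd⇒odd x (r * 2 + suc m) 3x-odd)

-- The enumeration (a n , b n) of the P-positions

module _ (a b : ℕ → ℕ)
         (a-mono : ∀ m n → 1 ≤ m → m < n → a m < a n)
         (ab-P : ∀ n → 1 ≤ n → (0 < a n × a n ≤ b n) × IsP (a n) (b n))
         (P-ab : ∀ x y → 0 < x → x ≤ y → IsP x y → ∃[ n ] (1 ≤ n × a n ≡ x × b n ≡ y)) where

  a-∈ : ∀ k → 1 ≤ k → EvenV₂ (a k)
  a-∈ k 1≤k = let ((ak>0 , ak≤bk) , isP) = ab-P k 1≤k in
    proj₁ (QueenBeeP-ordered ak>0 ak≤bk (to IsP⇔QueenBeeP isP))

  a-onto : ∀ {y} → EvenV₂ y → ∃[ j ] (1 ≤ j × a j ≡ y)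
  a-onto ey = let (j , 1≤j , aj≡y , _) = P-ab _ _ (EvenV₂⇒>0 ey) (m≤n*m _ 2) (IsP-double ey) in j , 1≤j , aj≡y

  defect-at : ∀ {x Y d} → EvenV₂ x → EvenV₂ Y → countEvenV₂ Y ≡ 2 * x → 3 * x ≡ Y + d
            → ∃[ n ] (1 ≤ n × ∣ ⁺ (a (b n)) - ⁺ (a n) - ⁺ (b n) ∣ ≡ d)
  defect-at {x} {Y} {d} ex eY cY≡2x 3x≡Y+d =
    let (n , 1≤n , an≡x , bn≡2x) = P-ab x (2 * x) (EvenV₂⇒>0 ex) (m≤n*m x 2) (IsP-double ex)
        abn≡Y = trans (cong a (trans bn≡2x (sym cY≡2x))) (a∘count EvenV₂? a a-mono (n≮0 ∘ EvenV₂⇒>0) a-∈ a-onto eY)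
    in  n , 1≤n , subst (λ (u , v , w) → ∣ ⁺ u - ⁺ v - ⁺ w ∣ ≡ d)
              (sym (cong₂ _,_ abn≡Y (cong₂ _,_ an≡x bn≡2x))) (∣y-x-2x∣ {x} 3x≡Y+d)

theorem4 : (a b : ℕ → ℕ)
    → (∀ m n → 1 ≤ m → m < n → a m < a n)
    → (∀ n → 1 ≤ n → (0 < a n × a n ≤ b n) × IsP (a n) (b n))
    → (∀ x y → 0 < x → x ≤ y → IsP x y → ∃[ n ] (1 ≤ n × a n ≡ x × b n ≡ y))
    → ∀ (M : ℕ) → ∃[ n ] (1 ≤ n × M < ∣ ⁺ (a (b n)) - ⁺ (a n) - ⁺ (b n) ∣)
theorem4 a b a-mono ab-P P-ab M =
  let (x , Y , ex , eY , cY≡2x , 3x≡Y+2d) = countEvenV₂-defect M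
      (n , 1≤n , defect≡2[M+1])            = defect-at a b a-mono ab-P P-ab ex eY cY≡2x 3x≡Y+2d
  in  n , 1≤n , subst (M <_) (sym defect≡2[M+1]) (m≤m*n (suc M) 2)
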